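{- Let $n\geq 3$ and let $C_n$ be the cycle on $n$ vertices. Then $vs_{\chi'}(C_n)=1$ if $n$ is odd, and $vs_{\chi'}(C_n)=\lceil \frac{n}{3}\rceil$ if $n$ is even.
   Context: All graphs are finite and simple. $\chi'$ is the chromatic index. The chromatic vertex stability number $vs_{\chi'}(G)$ of a nonempty graph $G$ is the minimum number of vertices of $G$ whose removal results in a graph $H\subseteq G$ with $\chi'(H)\neq\chi'(G)$ (or with no edges). -}

module Defs where

open import Data.Nat using (ℕ; zero; suc; _+_; _<_; _≤_; _%_; NonZero; s≤s; z≤n)
open import Data.Nat.DivMod using (m<n⇒m%n≡m; n%n≡0)
open import Data.Nat.Properties using (m≢1+n+m; +-comm; m≤n⇒m<n∨m≡n)
open import Data.Fin.Properties using (toℕ<n)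
open import Data.Sum using (inj₁; inj₂)
open import Relation.Binary.PropositionalEquality using (refl; cong; trans)
import Relation.Binary.PropositionalEquality as Eq
open import Data.Fin using (Fin; toℕ)
open import Data.Fin.Subset using (Subset; _∈_; _∉_; ∣_∣)
open import Data.Product using (Σ; _×_; ∃; ∃-syntax; _,_)
open import Data.Sum using (_⊎_)
open import Relation.Nullary using (¬_)
open import Relation.Binary.PropositionalEquality using (_≡_; _≢_)

record Graph : Set₁ where
  field
    size  : ℕ
    Adj   : Fin size → Fin size → Set
    irrefl : ∀ u → ¬ Adj u u
    sym   : ∀ u v → Adj u v → Adj v u
open Graph public

record ProperEdgeColouring (G : Graph) (k : ℕ) : Set where
  field
    col     : ∀ u v → Adj G u v → Fin k
    col-sym : ∀ u v (a : Adj G u v) → col u v a ≡ col v u (sym G u v a)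
    proper  : ∀ u v w (a : Adj G u v) (b : Adj G u w) → v ≢ w → col u v a ≢ col u w b

EdgeColourable : Graph → ℕ → Set
EdgeColourable G k = ProperEdgeColouring G k

IsChromaticIndex : Graph → ℕ → Set
IsChromaticIndex G k = EdgeColourable G k × (∀ j → j < k → ¬ EdgeColourable G j)

Edgeless : Graph → Set
Edgeless G = ∀ u v → ¬ Adj G u v

Nonempty : Graph → Set
Nonempty G = ∃[ u ] ∃[ v ] Adj G u v

-- We keep the vertex set but delete every
-- edge incident to a vertex of S; the removed vertices become isolated, which
-- affects neither the chromatic index nor edgelessness.
removeVertices : (G : Graph) → Subset (size G) → Graph
removeVertices G S = record
  { size   = size G
  ; Adj    = λ u v → (u ∉ S) × (v ∉ S) × Adj G u v
  ; irrefl = λ u (_ , _ , a) → irrefl G u a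
  ; sym    = λ u v (p , q , a) → q , p , sym G u v a
  }

Destroys : (G : Graph) → ℕ → Subset (size G) → Set
Destroys G k S = Edgeless (removeVertices G S) ⊎ ¬ IsChromaticIndex (removeVertices G S) k

IsChromaticVertexStability : Graph → ℕ → Set
IsChromaticVertexStability G m =
  ∀ k → IsChromaticIndex G k →
    (∃[ S ] (∣ S ∣ ≡ m × Destroys G k S))
    × (∀ S → ∣ S ∣ < m → ¬ Destroys G k S)

-- The cycle C_n on vertex set Fin n: i ~ j iff j ≡ i+1 (mod n) or i ≡ j+1 (mod n).
-- (Simple only for n ≥ 3.)
CycleAdj : (n : ℕ) .{{_ : NonZero n}} → Fin n → Fin n → Set
CycleAdj n i j = ((toℕ i + 1) % n ≡ toℕ j) ⊎ ((toℕ j + 1) % n ≡ toℕ i)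

private
  cyc-irr : ∀ k (i : Fin (suc (suc (suc k)))) → (toℕ i + 1) % suc (suc (suc k)) ≢ toℕ i
  cyc-irr k i eq rewrite +-comm (toℕ i) 1 with m≤n⇒m<n∨m≡n (toℕ<n i)
  ... | inj₁ lt = m≢1+n+m (toℕ i) {0} (trans (Eq.sym eq) (m<n⇒m%n≡m lt))
  ... | inj₂ e with toℕ i | eq
  cyc-irr k i eq | inj₂ refl | .(suc (suc k)) | eq' with trans (Eq.sym (n%n≡0 (suc (suc (suc k))))) eq'
  ... | ()

Cycle : (n : ℕ) → 3 ≤ n → Graph
Cycle (suc (suc (suc k))) _ = record
  { size   = suc (suc (suc k))
  ; Adj    = CycleAdj (suc (suc (suc k)))
  ; irrefl = λ u → λ { (inj₁ e) → cyc-irr k u e ; (inj₂ e) → cyc-irr k u e }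
  ; sym    = λ u v → λ { (inj₁ e) → inj₂ e ; (inj₂ e) → inj₁ e }
  }
Cycle zero ()
Cycle (suc zero) (s≤s ())
Cycle (suc (suc zero)) (s≤s (s≤s ()))

module Submission where

-- All
-- colourings below give the edge {i, next i} a label φ i of its tail; such a
-- colouring of C_n ∖ S is proper as soon as φ i ≠ φ (next i) whenever the
-- three consecutive vertices i, next i, next (next i) all survive.  This gives
--   * a parity 2-colouring of C_n ∖ S when n is even or the vertex 0 is deleted;
--   * a 1-colouring once every third vertex (a set S₀ of size ⌈n/3⌉) is deleted.
-- Conversely, three consecutive survivors force two colours, and an odd cycle
-- has no 2-colouring (going around, the edge colours must alternate).
-- Counting (each vertex lies in three of the n cyclic windows of length 3)
-- shows that deleting fewer than ⌈n/3⌉ vertices leaves such a window intact.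

open import Defs hiding (sym)
open import Data.Nat using (ℕ; _+_; _≤_; _/_)
open import Data.Nat.Divisibility using (_∣_)
open import Data.Product using (_×_)
open import Relation.Nullary using (¬_)

open import Data.Nat.Properties using (+-commutativeSemigroup)
open import Algebra.Properties.CommutativeSemigroup +-commutativeSemigroup using (interchange)
open import Data.Bool using (Bool; true; false)
open import Data.Empty using (⊥)
open import Data.Fin using (Fin; zero; suc; toℕ; fromℕ<; inject≤)
open import Data.Fin.Properties using (toℕ-injective; toℕ-fromℕ<; toℕ<n; inject≤-injective)
open import Data.Fin.Subset using (Subset; ⁅_⁆; ∣_∣; _∈_; _∉_; _⊆_) renaming (⊥ to ∅)
open import Data.Fin.Subset.Properties using (∉⊥; ∣⁅x⁆∣≡1; x∈⁅y⁆⇒x≡y; x∉⁅y⁆⇒x≢y; p⊆q⇒∣p∣≤∣q∣)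
open import Data.Nat using (zero; suc; _<_; _%_; _*_; s≤s; z≤n)
open import Data.Nat.DivMod using (m<n⇒m%n≡m; n%n≡0; m%n<n; m/n≡1+[m∸n]/n; m<n*o⇒m/o<n)
open import Data.Nat.Divisibility using (divides)
open import Data.Nat.Properties
  using (+-comm; +-assoc; +-identityʳ; +-cancelˡ-≡; +-monoˡ-≤; m≤n+m; m+n≡0⇒m≡0; m+n≡0⇒n≡0;
         m≤n⇒m<n∨m≡n; suc-injective; 0≢1+n; m≢1+n+m; n<1+n; n≮n; <⇒≤; <⇒≢; <⇒≱; ≰⇒>;
         ≤-pred; ≤-trans; ≤-antisym; ≮⇒≥; module ≤-Reasoning)
open import Data.Nat.Tactic.RingSolver using (solve-∀)
open import Data.Product using (∃-syntax; _,_)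
open import Data.Sum using (_⊎_; inj₁; inj₂)
open import Data.Vec using (_∷_; []; lookup; tabulate; here)
open import Data.Vec.Properties using ([]=⇒lookup; lookup⇒[]=; lookup∘tabulate)
open import Function using (_∘_)
open import Relation.Nullary using (contradiction)
open import Relation.Binary.PropositionalEquality
  using (_≡_; _≢_; refl; sym; trans; cong; cong₂; subst; module ≡-Reasoning)


_∖_ : (G : Graph) → Subset (size G) → Graph
G ∖ S = removeVertices G S

weaken : ∀ {G c d} → c ≤ d → EdgeColourable G c → EdgeColourable G d
weaken c≤d P = record
  { col     = λ u v a → inject≤ (col u v a) c≤d
  ; col-sym = λ u v a → cong (λ x → inject≤ x c≤d) (col-sym u v a)
  ; proper  = λ u v w a b v≢w e → proper u v w a b v≢w (inject≤-injective c≤d c≤d _ _ e)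
  }
  where open ProperEdgeColouring P

isChromaticIndex-intro : ∀ {G c} → EdgeColourable G (suc c) → ¬ EdgeColourable G c →
                         IsChromaticIndex G (suc c)
isChromaticIndex-intro P ¬P = P , λ j j<1+c Pj → ¬P (weaken (≤-pred j<1+c) Pj)

chromaticIndex-unique : ∀ {G k k′} → IsChromaticIndex G k → IsChromaticIndex G k′ → k ≡ k′
chromaticIndex-unique (P , min) (P′ , min′) =
  ≤-antisym (≮⇒≥ λ k′<k → min _ k′<k P′) (≮⇒≥ λ k<k′ → min′ _ k<k′ P)

chromaticIndex-> : ∀ {G c k} → ¬ EdgeColourable G c → IsChromaticIndex G k → c < k
chromaticIndex-> ¬P (P , _) = ≰⇒> λ k≤c → ¬P (weaken k≤c P)

restrict : ∀ {G c} (S : Subset (size G)) → EdgeColourable G c → EdgeColourable (G ∖ S) c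
restrict S P = record
  { col     = λ u v (_ , _ , a) → col u v a
  ; col-sym = λ u v (_ , _ , a) → col-sym u v a
  ; proper  = λ u v w (_ , _ , a) (_ , _ , b) → proper u v w a b
  }
  where open ProperEdgeColouring P

extend : ∀ {G c} {S : Subset (size G)} → (∀ i → i ∉ S) → EdgeColourable (G ∖ S) c →
         EdgeColourable G c
extend none P = record
  { col     = λ u v a → col u v (none u , none v , a)
  ; col-sym = λ u v a → col-sym u v (none u , none v , a)
  ; proper  = λ u v w a b → proper u v w (none u , none v , a) (none u , none w , b)
  }
  where open ProperEdgeColouring P

removeNothing-index : ∀ {G k} {S : Subset (size G)} → (∀ i → i ∉ S) →
                      IsChromaticIndex G k → IsChromaticIndex (G ∖ S) k
removeNothing-index {S = S} none (P , min) =
  restrict S P , λ j j<k Pj → min j j<k (extend none Pj)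

destroys-by-colouring : ∀ {G c k} {S : Subset (size G)} →
                        EdgeColourable (G ∖ S) c → c < k → Destroys G k S
destroys-by-colouring P c<k = inj₂ λ (_ , min) → min _ c<k P

¬destroys : ∀ {G k} {S : Subset (size G)} →
            ¬ Edgeless (G ∖ S) → IsChromaticIndex (G ∖ S) k → ¬ Destroys G k S
¬destroys hasEdge _ (inj₁ edgeless) = hasEdge edgeless
¬destroys _ index (inj₂ ¬index) = ¬index index

small⇒empty : ∀ {n} {S : Subset n} → ∣ S ∣ < 1 → ∀ i → i ∉ S
small⇒empty {S = S} small i i∈S = n≮n 1 (begin-strict
  1         ≡⟨ sym (∣⁅x⁆∣≡1 i) ⟩
  ∣ ⁅ i ⁆ ∣ ≤⟨ p⊆q⇒∣p∣≤∣q∣ ⁅i⁆⊆S ⟩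
  ∣ S ∣     <⟨ small ⟩
  1         ∎)
  where
  open ≤-Reasoning
  ⁅i⁆⊆S : ⁅ i ⁆ ⊆ S
  ⁅i⁆⊆S j∈ = subst (_∈ S) (sym (x∈⁅y⁆⇒x≡y i j∈)) i∈S


sumBelow : ℕ → (ℕ → ℕ) → ℕ
sumBelow zero    f = 0
sumBelow (suc n) f = f 0 + sumBelow n (f ∘ suc)

sumBelow-snoc : ∀ n f → sumBelow (suc n) f ≡ sumBelow n f + f n
sumBelow-snoc zero    f = +-identityʳ (f 0)
sumBelow-snoc (suc n) f =
  trans (cong (f 0 +_) (sumBelow-snoc n (f ∘ suc))) (sym (+-assoc (f 0) _ _))

sumBelow-+ : ∀ f g n → sumBelow n (λ j → f j + g j) ≡ sumBelow n f + sumBelow n g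
sumBelow-+ f g zero    = refl
sumBelow-+ f g (suc n) =
  trans (cong (f 0 + g 0 +_) (sumBelow-+ (f ∘ suc) (g ∘ suc) n)) (interchange (f 0) (g 0) _ _)

sumBelow-rotate : ∀ f n → f n ≡ f 0 → sumBelow n (f ∘ suc) ≡ sumBelow n f
sumBelow-rotate f n periodic = +-cancelˡ-≡ (f 0) _ _ (begin
  sumBelow (suc n) f      ≡⟨ sumBelow-snoc n f ⟩
  sumBelow n f + f n      ≡⟨ cong (sumBelow n f +_) periodic ⟩
  sumBelow n f + f 0      ≡⟨ +-comm (sumBelow n f) (f 0) ⟩
  f 0 + sumBelow n f      ∎)
  where open ≡-Reasoning

zero-term : ∀ n (w : ℕ → ℕ) → sumBelow n w < n → ∃[ j ] w j ≡ 0
zero-term (suc n) w small with w 0 in w0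
... | zero  = 0 , w0
... | suc m with zero-term n (w ∘ suc) (≤-trans (s≤s (m≤n+m _ m)) (≤-pred small))
...   | j , wj = suc j , wj

bit : Bool → ℕ
bit true  = 1
bit false = 0

∣∷∣ : ∀ {n} b (p : Subset n) → ∣ b ∷ p ∣ ≡ bit b + ∣ p ∣
∣∷∣ true  p = refl
∣∷∣ false p = refl

size≡sum : ∀ {n} (p : Subset n) (h : ℕ → ℕ) → (∀ i → h (toℕ i) ≡ bit (lookup p i)) →
           ∣ p ∣ ≡ sumBelow n h
size≡sum []      h _  = refl
size≡sum (b ∷ p) h eq =
  trans (∣∷∣ b p) (cong₂ _+_ (sym (eq zero)) (size≡sum p (h ∘ suc) (eq ∘ suc)))

below-ceil-third : ∀ n s → s < (n + 2) / 3 → s + s + s < n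
below-ceil-third n s small = ≰⇒> λ n≤3s → <⇒≱ small (≤-pred (m<n*o⇒m/o<n (begin-strict
  n + 2                ≤⟨ +-monoˡ-≤ 2 n≤3s ⟩
  s + s + s + 2        <⟨ n<1+n _ ⟩
  suc (s + s + s + 2)  ≡⟨ three-blocks s ⟩
  suc s * 3            ∎)))
  where
  open ≤-Reasoning
  three-blocks : ∀ s → suc (s + s + s + 2) ≡ suc s * 3
  three-blocks = solve-∀

every3rd : ℕ → Bool
every3rd 0                   = true
every3rd 1                   = false
every3rd 2                   = false
every3rd (suc (suc (suc j))) = every3rd j

every3rd-window : ∀ j → every3rd j ≡ false → every3rd (suc j) ≡ false →
                  every3rd (suc (suc j)) ≡ false → ⊥
every3rd-window 0 () _ _
every3rd-window 1 _ _ ()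
every3rd-window 2 _ () _
every3rd-window (suc (suc (suc j))) = every3rd-window j

count-every3rd : ∀ n → sumBelow n (bit ∘ every3rd) ≡ (n + 2) / 3
count-every3rd 0 = refl
count-every3rd 1 = refl
count-every3rd 2 = refl
count-every3rd (suc (suc (suc n))) = begin
  suc (sumBelow n (bit ∘ every3rd))  ≡⟨ cong suc (count-every3rd n) ⟩
  suc ((n + 2) / 3)                  ≡⟨ sym (m/n≡1+[m∸n]/n {suc (suc (suc n)) + 2} 3≤n+5) ⟩
  (suc (suc (suc n)) + 2) / 3        ∎
  where
  open ≡-Reasoning
  3≤n+5 : 3 ≤ suc (suc (suc n)) + 2
  3≤n+5 = s≤s (s≤s (s≤s z≤n))


swap : Fin 2 → Fin 2
swap zero       = suc zero
swap (suc zero) = zero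

swap-≢ : ∀ a → swap a ≢ a
swap-≢ zero       ()
swap-≢ (suc zero) ()

swap-involutive : ∀ a → swap (swap a) ≡ a
swap-involutive zero       = refl
swap-involutive (suc zero) = refl

other-colour : ∀ {a b : Fin 2} → a ≢ b → b ≡ swap a
other-colour {zero}     {zero}     a≢b = contradiction refl a≢b
other-colour {zero}     {suc zero} _   = refl
other-colour {suc zero} {zero}     _   = refl
other-colour {suc zero} {suc zero} a≢b = contradiction refl a≢b

swaps : ℕ → Fin 2 → Fin 2
swaps zero    a = a
swaps (suc n) a = swap (swaps n a)

swaps-even : ∀ q a → swaps (q * 2) a ≡ a
swaps-even zero    a = refl
swaps-even (suc q) a = trans (swap-involutive _) (swaps-even q a)

swaps-fixed⇒even : ∀ n a → swaps n a ≡ a → 2 ∣ n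
swaps-fixed⇒even zero                a _     = divides 0 refl
swaps-fixed⇒even (suc zero)          a fixed = contradiction fixed (swap-≢ a)
swaps-fixed⇒even (suc (suc n))       a fixed
  with swaps-fixed⇒even n a (trans (sym (swap-involutive _)) fixed)
... | divides q n≡q*2 = divides (suc q) (cong (2 +_) n≡q*2)

parity : ℕ → Fin 2
parity n = swaps n zero


module CycleFacts (k : ℕ) where

  N : ℕ
  N = suc (suc (suc k))

  Cₙ : Graph
  Cₙ = Cycle N (s≤s (s≤s (s≤s z≤n)))

  next : Fin N → Fin N
  next i = fromℕ< (m%n<n (toℕ i + 1) N)

  next-spec : ∀ i → (toℕ i + 1) % N ≡ toℕ (next i)
  next-spec i = sym (toℕ-fromℕ< _)

  next-unique : ∀ i {j} → (toℕ i + 1) % N ≡ toℕ j → next i ≡ j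
  next-unique i e = toℕ-injective (trans (sym (next-spec i)) e)

  edge : ∀ i → Adj Cₙ i (next i)
  edge i = inj₁ (next-spec i)

  next-cases : ∀ i → (suc (toℕ i) ≡ N × next i ≡ zero) ⊎ toℕ (next i) ≡ suc (toℕ i)
  next-cases i with m≤n⇒m<n∨m≡n (toℕ<n i)
  ... | inj₁ 1+i<N = inj₂ (trans (sym (next-spec i))
                            (trans (cong (_% N) (+-comm (toℕ i) 1)) (m<n⇒m%n≡m 1+i<N)))
  ... | inj₂ 1+i≡N = inj₁ (1+i≡N , next-unique i
                            (trans (cong (_% N) (trans (+-comm (toℕ i) 1) 1+i≡N)) (n%n≡0 N)))

  next-injective : ∀ {i j} → next i ≡ next j → i ≡ j
  next-injective {i} {j} e with next-cases i | next-cases j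
  ... | inj₁ (wi , _)  | inj₁ (wj , _)  = toℕ-injective (suc-injective (trans wi (sym wj)))
  ... | inj₁ (_ , zi)  | inj₂ sj        = contradiction (trans (cong toℕ (trans (sym zi) e)) sj) 0≢1+n
  ... | inj₂ si        | inj₁ (_ , zj)  = contradiction (trans (cong toℕ (trans (sym zj) (sym e))) si) 0≢1+n
  ... | inj₂ si        | inj₂ sj        =
    toℕ-injective (suc-injective (trans (sym si) (trans (cong toℕ e) sj)))

  next²≢id : ∀ i → next (next i) ≢ i
  next²≢id i e with next-cases i | next-cases (next i)
  ... | inj₂ si | inj₂ ssi =
    m≢1+n+m (toℕ i) (trans (cong toℕ (sym e)) (trans ssi (cong suc si)))
  ... | inj₁ (wi , zi) | inj₂ ssi = N≢2 (begin
    N                               ≡⟨ sym wi ⟩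
    suc (toℕ i)                     ≡⟨ cong (λ v → 1 + toℕ v) (sym e) ⟩
    suc (toℕ (next (next i)))       ≡⟨ cong suc ssi ⟩
    suc (suc (toℕ (next i)))        ≡⟨ cong (λ v → 2 + toℕ v) zi ⟩
    2                               ∎)
    where
    open ≡-Reasoning
    N≢2 : N ≢ 2
    N≢2 ()
  ... | inj₁ (_ , zi) | inj₁ (wni , _) = N≢1 (trans (sym wni) (cong (λ v → 1 + toℕ v) zi))
    where
    N≢1 : N ≢ 1
    N≢1 ()
  ... | inj₂ si | inj₁ (wni , zni) = N≢2 (begin
    N                               ≡⟨ sym wni ⟩
    suc (toℕ (next i))              ≡⟨ cong suc si ⟩
    suc (suc (toℕ i))               ≡⟨ cong (λ v → 2 + toℕ v) (trans (sym e) zni) ⟩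
    2                               ∎)
    where
    open ≡-Reasoning
    N≢2 : N ≢ 2
    N≢2 ()

  walk : ℕ → Fin N
  walk zero    = zero
  walk (suc j) = next (walk j)

  toℕ-walk : ∀ {j} → j < N → toℕ (walk j) ≡ j
  toℕ-walk {zero}  _      = refl
  toℕ-walk {suc j} 1+j<N with next-cases (walk j)
  ... | inj₂ s       = trans s (cong suc (toℕ-walk (<⇒≤ 1+j<N)))
  ... | inj₁ (w , _) = contradiction (trans (cong suc (sym (toℕ-walk (<⇒≤ 1+j<N)))) w)
                                     (<⇒≢ 1+j<N)

  walk-toℕ : ∀ i → walk (toℕ i) ≡ i
  walk-toℕ i = toℕ-injective (toℕ-walk (toℕ<n i))

  walk-N : walk N ≡ zero
  walk-N with next-cases (walk (suc (suc k)))
  ... | inj₁ (_ , z) = z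
  ... | inj₂ s = contradiction
    (subst (_< N) (trans s (cong suc (toℕ-walk (n<1+n _)))) (toℕ<n (walk N))) (n≮n N)

  -- Labels φ of the vertices separate i from next i whenever the two edges at
  -- next i both survive in Cₙ ∖ S.
  SeparatesConsecutive : ∀ {c} → Subset N → (Fin N → Fin c) → Set
  SeparatesConsecutive S φ =
    ∀ i → i ∉ S → next i ∉ S → next (next i) ∉ S → φ i ≢ φ (next i)

  labelColouring : ∀ {c} (S : Subset N) (φ : Fin N → Fin c) → SeparatesConsecutive S φ →
                   EdgeColourable (Cₙ ∖ S) c
  labelColouring {c} S φ separates = record { col = col ; col-sym = col-sym ; proper = proper }
    where
    col : ∀ u v → Adj (Cₙ ∖ S) u v → Fin c
    col u v (_ , _ , inj₁ _) = φ u
    col u v (_ , _ , inj₂ _) = φ v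

    col-sym : ∀ u v (a : Adj (Cₙ ∖ S) u v) → col u v a ≡ col v u (Graph.sym (Cₙ ∖ S) u v a)
    col-sym u v (_ , _ , inj₁ _) = refl
    col-sym u v (_ , _ , inj₂ _) = refl

    separated : ∀ {p u v} → p ∉ S → u ∉ S → v ∉ S → next p ≡ u → next u ≡ v → φ p ≢ φ u
    separated {p} p∉ u∉ v∉ refl refl = separates p p∉ u∉ v∉

    proper : ∀ u v w (a : Adj (Cₙ ∖ S) u v) (b : Adj (Cₙ ∖ S) u w) → v ≢ w → col u v a ≢ col u w b
    proper u v w (_ , _ , inj₁ uv) (_ , _ , inj₁ uw) v≢w _ =
      v≢w (trans (sym (next-unique u uv)) (next-unique u uw))
    proper u v w (_ , _ , inj₂ vu) (_ , _ , inj₂ wu) v≢w _ =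
      v≢w (next-injective (trans (next-unique v vu) (sym (next-unique w wu))))
    proper u v w (u∉ , v∉ , inj₁ uv) (_ , w∉ , inj₂ wu) _ =
      separated w∉ u∉ v∉ (next-unique w wu) (next-unique u uv) ∘ sym
    proper u v w (u∉ , v∉ , inj₂ vu) (_ , w∉ , inj₁ uw) _ =
      separated v∉ u∉ w∉ (next-unique v vu) (next-unique u uw)

  parity-next : ∀ i → (next i ≡ zero → 2 ∣ N) → parity (toℕ (next i)) ≡ swap (parity (toℕ i))
  parity-next i wrapEven with next-cases i
  ... | inj₂ s = cong parity s
  ... | inj₁ (wrap , z) with wrapEven z
  ...   | divides q N≡q*2 = begin
    parity (toℕ (next i))   ≡⟨ cong (parity ∘ toℕ) z ⟩
    zero                    ≡⟨ sym (swaps-even q zero) ⟩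
    parity (q * 2)          ≡⟨ cong parity (sym N≡q*2) ⟩
    parity N                ≡⟨ cong parity (sym wrap) ⟩
    swap (parity (toℕ i))   ∎
    where open ≡-Reasoning

  parityColouring : ∀ S → (∀ i → i ∉ S → next i ∉ S → next i ≡ zero → 2 ∣ N) →
                    EdgeColourable (Cₙ ∖ S) 2
  parityColouring S wrapEven = labelColouring S (parity ∘ toℕ) λ i i∉ ni∉ _ e →
    swap-≢ (parity (toℕ i)) (trans (sym (parity-next i (wrapEven i i∉ ni∉))) (sym e))

  evenColouring : 2 ∣ N → ∀ S → EdgeColourable (Cₙ ∖ S) 2
  evenColouring even S = parityColouring S λ _ _ _ _ → even

  -- Deleting the vertex 0 leaves a path, which is 2-edge-colourable.
  pathColouring : EdgeColourable (Cₙ ∖ ⁅ zero ⁆) 2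
  pathColouring = parityColouring ⁅ zero ⁆ λ _ _ ni∉ ni≡0 → contradiction ni≡0 (x∉⁅y⁆⇒x≢y ni∉)

  -- Three consecutive surviving vertices carry two adjacent edges.
  consecutive-not1 : ∀ {S u} → u ∉ S → next u ∉ S → next (next u) ∉ S →
                     ¬ EdgeColourable (Cₙ ∖ S) 1
  consecutive-not1 {u = u} u∉ nu∉ nnu∉ P =
    proper (next u) u (next (next u)) (nu∉ , u∉ , inj₂ (next-spec u)) (nu∉ , nnu∉ , edge (next u))
           (next²≢id u ∘ sym) (single _ _)
    where
    open ProperEdgeColouring P
    single : (a b : Fin 1) → a ≡ b
    single zero zero = refl

  cycle-not1 : ¬ EdgeColourable Cₙ 1
  cycle-not1 P = consecutive-not1 {∅} {zero} ∉⊥ ∉⊥ ∉⊥ (restrict ∅ P)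

  edge-survives : ∀ {S u} → u ∉ S → next u ∉ S → ¬ Edgeless (Cₙ ∖ S)
  edge-survives {u = u} u∉ nu∉ edgeless = edgeless u (next u) (u∉ , nu∉ , edge u)

  -- In a 2-edge-colouring the colours of {u, next u} alternate around the cycle,
  -- so N must be even.
  odd-not2 : ¬ 2 ∣ N → ¬ EdgeColourable Cₙ 2
  odd-not2 odd P = odd (swaps-fixed⇒even N (c zero) (begin
    swaps N (c zero)  ≡⟨ sym (c-walk N) ⟩
    c (walk N)        ≡⟨ cong c walk-N ⟩
    c zero            ∎))
    where
    open ≡-Reasoning
    open ProperEdgeColouring P
    c : Fin N → Fin 2
    c u = col u (next u) (edge u)
    c-next : ∀ u → c (next u) ≡ swap (c u)
    c-next u = other-colour λ e →
      proper (next u) u (next (next u)) (Graph.sym Cₙ u (next u) (edge u)) (edge (next u))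
             (next²≢id u ∘ sym) (trans (sym (col-sym u (next u) (edge u))) e)
    c-walk : ∀ j → c (walk j) ≡ swaps j (c zero)
    c-walk zero    = refl
    c-walk (suc j) = trans (c-next (walk j)) (cong swap (c-walk j))

  cycle-index-even : 2 ∣ N → IsChromaticIndex Cₙ 2
  cycle-index-even even =
    isChromaticIndex-intro (extend (λ _ → ∉⊥) (evenColouring even ∅)) cycle-not1

  S₀ : Subset N
  S₀ = tabulate (every3rd ∘ toℕ)

  ∣S₀∣ : ∣ S₀ ∣ ≡ (N + 2) / 3
  ∣S₀∣ = trans (size≡sum S₀ (bit ∘ every3rd) λ i → cong bit (sym (lookup∘tabulate (every3rd ∘ toℕ) i)))
               (count-every3rd N)

  outside-S₀ : ∀ {i} → i ∉ S₀ → every3rd (toℕ i) ≡ false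
  outside-S₀ {i} i∉ with every3rd (toℕ i) in eq
  ... | false = refl
  ... | true  = contradiction
    (lookup⇒[]= i S₀ (trans (lookup∘tabulate (every3rd ∘ toℕ) i) eq)) i∉

  -- The vertex 0 lies in S₀, so no surviving edge wraps around.
  zero∈S₀ : zero ∈ S₀
  zero∈S₀ = here

  -- No three consecutive vertices avoid S₀, so the constant labelling separates.
  S₀-separates : SeparatesConsecutive {1} S₀ (λ _ → zero)
  S₀-separates i i∉ ni∉ nni∉ _ with next-cases i | next-cases (next i)
  ... | inj₁ (_ , z) | _            = ni∉ (subst (_∈ S₀) (sym z) zero∈S₀)
  ... | inj₂ _       | inj₁ (_ , z) = nni∉ (subst (_∈ S₀) (sym z) zero∈S₀)
  ... | inj₂ s₁      | inj₂ s₂      = every3rd-window (toℕ i) (outside-S₀ i∉)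
    (trans (cong every3rd (sym s₁)) (outside-S₀ ni∉))
    (trans (cong every3rd (sym (trans s₂ (cong suc s₁)))) (outside-S₀ nni∉))

  -- Deleting S₀ leaves a matching, which is 1-edge-colourable.
  matchingColouring : EdgeColourable (Cₙ ∖ S₀) 1
  matchingColouring = labelColouring S₀ (λ _ → zero) S₀-separates

  mark : Subset N → ℕ → ℕ
  mark S j = bit (lookup S (walk j))

  unmarked : ∀ {S j} → mark S j ≡ 0 → walk j ∉ S
  unmarked m≡0 j∈S = 0≢1+n (trans (sym m≡0) (cong bit ([]=⇒lookup j∈S)))

  window : Subset N → ℕ → ℕ
  window S j = mark S j + mark S (suc j) + mark S (suc (suc j))

  windowSum : ∀ S → sumBelow N (window S) ≡ ∣ S ∣ + ∣ S ∣ + ∣ S ∣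
  windowSum S = begin
    sumBelow N (λ j → m j + m₁ j + m₂ j)
      ≡⟨ sumBelow-+ (λ j → m j + m₁ j) m₂ N ⟩
    sumBelow N (λ j → m j + m₁ j) + sumBelow N m₂
      ≡⟨ cong (_+ sumBelow N m₂) (sumBelow-+ m m₁ N) ⟩
    sumBelow N m + sumBelow N m₁ + sumBelow N m₂
      ≡⟨ cong₂ (λ x y → sumBelow N m + x + y) rotate₁ (trans rotate₂ rotate₁) ⟩
    sumBelow N m + sumBelow N m + sumBelow N m
      ≡⟨ cong (λ x → x + x + x) (sym ∣S∣≡Σm) ⟩
    ∣ S ∣ + ∣ S ∣ + ∣ S ∣ ∎
    where
    open ≡-Reasoning
    m m₁ m₂ : ℕ → ℕ
    m j  = mark S j
    m₁ j = mark S (suc j)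
    m₂ j = mark S (suc (suc j))
    ∣S∣≡Σm : ∣ S ∣ ≡ sumBelow N m
    ∣S∣≡Σm = size≡sum S m (λ i → cong (λ v → bit (lookup S v)) (walk-toℕ i))
    rotate₁ : sumBelow N m₁ ≡ sumBelow N m
    rotate₁ = sumBelow-rotate m N (cong (λ v → bit (lookup S v)) walk-N)
    rotate₂ : sumBelow N m₂ ≡ sumBelow N m₁
    rotate₂ = sumBelow-rotate m₁ N (cong (λ v → bit (lookup S (next v))) walk-N)

  free-window : ∀ S → ∣ S ∣ < (N + 2) / 3 → ∃[ u ] (u ∉ S × next u ∉ S × next (next u) ∉ S)
  free-window S small
    with zero-term N (window S) (subst (_< N) (sym (windowSum S)) (below-ceil-third N ∣ S ∣ small))
  ... | j , w≡0 = walk j , unmarked {S} {j} (m+n≡0⇒m≡0 (mark S j) first-two≡0)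
                         , unmarked {S} {suc j} (m+n≡0⇒n≡0 (mark S j) first-two≡0)
                         , unmarked {S} {suc (suc j)} (m+n≡0⇒n≡0 (mark S j + mark S (suc j)) w≡0)
    where
    first-two≡0 : mark S j + mark S (suc j) ≡ 0
    first-two≡0 = m+n≡0⇒m≡0 (mark S j + mark S (suc j)) w≡0

  -- Odd cycles: χ' > 2, deleting one vertex leaves a 2-colourable path, and
  -- deleting nothing changes nothing.
  oddCase : ¬ 2 ∣ N → IsChromaticVertexStability Cₙ 1
  oddCase odd κ index =
    (⁅ zero ⁆ , ∣⁅x⁆∣≡1 {N} zero
              , destroys-by-colouring pathColouring (chromaticIndex-> (odd-not2 odd) index))
    , λ S small → let none = small⇒empty small in
        ¬destroys (edge-survives (none zero) (none (next zero))) (removeNothing-index none index)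

  -- Even cycles: χ' = 2, deleting S₀ leaves a matching, and any smaller deletion
  -- keeps two adjacent edges, hence χ' = 2.
  evenCase : 2 ∣ N → IsChromaticVertexStability Cₙ ((N + 2) / 3)
  evenCase even κ index =
    (S₀ , ∣S₀∣ , destroys-by-colouring matchingColouring (chromaticIndex-> cycle-not1 index))
    , stable
    where
    κ≡2 : 2 ≡ κ
    κ≡2 = chromaticIndex-unique (cycle-index-even even) index
    keeps : ∀ S → ∃[ u ] (u ∉ S × next u ∉ S × next (next u) ∉ S) → ¬ Destroys Cₙ κ S
    keeps S (u , u∉ , nu∉ , nnu∉) = ¬destroys (edge-survives u∉ nu∉)
      (subst (IsChromaticIndex (Cₙ ∖ S)) κ≡2
        (isChromaticIndex-intro (evenColouring even S) (consecutive-not1 u∉ nu∉ nnu∉)))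
    stable : ∀ S → ∣ S ∣ < (N + 2) / 3 → ¬ Destroys Cₙ κ S
    stable S small = keeps S (free-window S small)

mainTheorem9 : (n : ℕ) (h : 3 ≤ n) →
    (¬ (2 ∣ n) → IsChromaticVertexStability (Cycle n h) 1)
    × (2 ∣ n → IsChromaticVertexStability (Cycle n h) ((n + 2) / 3))
mainTheorem9 (suc zero)       (s≤s ())
mainTheorem9 (suc (suc zero)) (s≤s (s≤s ()))
mainTheorem9 (suc (suc (suc k))) _ = oddCase , evenCase
  where open CycleFacts k
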